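{- Let $G_1$ and $G_2$ be finite simple graphs, where $G_i$ has order $n_i$, minimum degree $\delta_i$, maximum degree $\Delta_i$ and independence number $\alpha(G_i)$, $i\in\{1,2\}$. Then for every integer $k \in\{ 1-\delta_1-\delta_2,\dots,\Delta_1+\Delta_2\}$, $$\phi_{k}^d(G_1\times G_2)\ge \alpha(G_1)\alpha(G_2)+\min\{n_1-\alpha(G_1),\,n_2-\alpha(G_2)\}.$$
   Context: All graphs are finite and simple. For a graph $G=(V,E)$, a set $S\subseteq V$ and a vertex $v\in V$, $\delta_S(v)=|\{u\in S: uv\in E\}|$ and $\overline{S}=V\setminus S$. For an integer $k$, a non-empty set $S\subseteq V$ is a defensive $k$-alliance if $\delta_S(v)\ge \delta_{\overline{S}}(v)+k$ for every $v\in S$. A set $X\subseteq V$ is defensive $k$-alliance free ($k$-daf) if $X$ contains no defensive $k$-alliance as a subset. $\phi_k^d(G)$ denotes the maximum cardinality of a $k$-daf set in $G$. The Cartesian product $G_1\times G_2$ of $G_1=(V_1,E_1)$ and $G_2=(V_2,E_2)$ has vertex set $V_1\times V_2$, with $(a,b)$ adjacent to $(c,d)$ iff either $a=c$ and $bd\in E_2$, or $b=d$ and $ac\in E_1$. -}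

module Defs where

open import Data.Nat using (ℕ; _≤_; _*_)
open import Data.Integer as ℤ using (ℤ; +_)
open import Data.Bool using (Bool; true; false; _∧_; _∨_)
open import Data.Fin using (Fin; remQuot)
open import Data.Fin.Properties using (_≟_)
open import Data.Fin.Subset using (Subset; _∈_; _⊆_; ∁; _∩_; ∣_∣; Nonempty)
open import Data.Product using (Σ; ∃; _×_; _,_; proj₁; proj₂)
open import Data.Vec using (tabulate)
open import Relation.Nullary using (¬_; yes; no)
open import Data.Empty using (⊥-elim)
open import Relation.Nullary.Decidable using (⌊_⌋)
open import Relation.Binary.PropositionalEquality using (_≡_; refl) renaming (sym to ≡-sym)

record Graph (n : ℕ) : Set where
  field
    adj    : Fin n → Fin n → Bool
    sym    : ∀ u v → adj u v ≡ adj v u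
    irrefl : ∀ v → adj v v ≡ false
open Graph public

N : ∀ {n} → Graph n → Fin n → Subset n
N G v = tabulate (adj G v)

deg : ∀ {n} → Graph n → Fin n → ℕ
deg G v = ∣ N G v ∣

δ[_]_ : ∀ {n} → Graph n → Subset n → Fin n → ℕ
δ[ G ] S = λ v → ∣ S ∩ N G v ∣

IsMinDegree : ∀ {n} → Graph n → ℕ → Set
IsMinDegree G d = (∃ λ v → deg G v ≡ d) × (∀ v → d ≤ deg G v)

IsMaxDegree : ∀ {n} → Graph n → ℕ → Set
IsMaxDegree G d = (∃ λ v → deg G v ≡ d) × (∀ v → deg G v ≤ d)

Independent : ∀ {n} → Graph n → Subset n → Set
Independent G I = ∀ u v → u ∈ I → v ∈ I → adj G u v ≡ false

IsIndependenceNumber : ∀ {n} → Graph n → ℕ → Set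
IsIndependenceNumber G a =
  (Σ (Subset _) λ I → Independent G I × ∣ I ∣ ≡ a)
  × (∀ I → Independent G I → ∣ I ∣ ≤ a)

≟-sym : ∀ {n} (p r : Fin n) → ⌊ p ≟ r ⌋ ≡ ⌊ r ≟ p ⌋
≟-sym p r with p ≟ r | r ≟ p
... | yes _   | yes _   = refl
... | no _    | no _    = refl
... | yes p≡r | no r≢p  = ⊥-elim (r≢p (≡-sym p≡r))
... | no p≢r  | yes r≡p = ⊥-elim (p≢r (≡-sym r≡p))

≟-refl : ∀ {n} (p : Fin n) → ⌊ p ≟ p ⌋ ≡ true
≟-refl p with p ≟ p
... | yes _ = refl
... | no p≢p = ⊥-elim (p≢p refl)

□adj : ∀ {n₁ n₂} → Graph n₁ → Graph n₂ → Fin n₁ × Fin n₂ → Fin n₁ × Fin n₂ → Bool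
□adj G H (p , q) (r , t) = (⌊ p ≟ r ⌋ ∧ adj H q t) ∨ (⌊ q ≟ t ⌋ ∧ adj G p r)

□adj-sym : ∀ {n₁ n₂} (G : Graph n₁) (H : Graph n₂) x y → □adj G H x y ≡ □adj G H y x
□adj-sym G H (p , q) (r , t)
  rewrite ≟-sym p r | ≟-sym q t | sym G p r | sym H q t = refl

□adj-irrefl : ∀ {n₁ n₂} (G : Graph n₁) (H : Graph n₂) x → □adj G H x x ≡ false
□adj-irrefl G H (p , q) rewrite ≟-refl p | ≟-refl q | irrefl G p | irrefl H q = refl

-- Cartesian product G₁ × G₂; its vertex set Fin (n₁ * n₂) is identified
-- with Fin n₁ × Fin n₂ via the bijection remQuot (inverse of combine).
_□_ : ∀ {n₁ n₂} → Graph n₁ → Graph n₂ → Graph (n₁ * n₂)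
_□_ {n₁} {n₂} G H = record
  { adj    = λ x y → □adj G H (remQuot {n₁} n₂ x) (remQuot {n₁} n₂ y)
  ; sym    = λ x y → □adj-sym G H (remQuot {n₁} n₂ x) (remQuot {n₁} n₂ y)
  ; irrefl = λ x → □adj-irrefl G H (remQuot {n₁} n₂ x)
  }

IsDefensiveAlliance : ∀ {n} → Graph n → ℤ → Subset n → Set
IsDefensiveAlliance G k S =
  Nonempty S × (∀ v → v ∈ S → + (δ[ G ] (∁ S)) v ℤ.+ k ℤ.≤ + (δ[ G ] S) v)

IsDAF : ∀ {n} → Graph n → ℤ → Subset n → Set
IsDAF G k X = ∀ S → S ⊆ X → ¬ IsDefensiveAlliance G k S

-- φ_k^d(G) ≥ m : some k-daf set has cardinality at least m
φ≥ : ∀ {n} → Graph n → ℤ → ℕ → Set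
φ≥ G k m = Σ (Subset _) λ X → IsDAF G k X × m ≤ ∣ X ∣

module Submission where

-- Take maximum independent sets I₁ of G₁ and I₂ of G₂, and a matching M
-- pairing min(n₁ - α₁, n₂ - α₂) vertices outside I₁ injectively with
-- vertices outside I₂.  The set X = (I₁ × I₂) ∪ M has the required size and
-- is independent in G₁ □ G₂: each of its rows (columns) either lies inside
-- I₂ (I₁) or has at most one element.  Every vertex of G₁ □ G₂ has degree
-- deg a + deg b ≥ δ₁ + δ₂, and an independent set in a graph of minimum
-- degree d is defensive k-alliance free for all k ≥ 1 - d, since a vertex
-- of S ⊆ X has no neighbour in S.

open import Defs
open import Data.Nat using (ℕ; _+_; _*_; _∸_; _⊓_)
open import Data.Integer using (ℤ; +_; _≤_; _-_) renaming (_+_ to _+ℤ_)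

open import Data.Nat using (zero; suc) renaming (_≤_ to _≤ℕ_)
open import Data.Integer using (+≤+)
import Data.Nat.Properties as ℕP
import Data.Integer.Properties as ℤP
open import Data.Integer.Tactic.RingSolver using (solve-∀)
open import Data.Bool using (Bool; true; false; _∧_; _∨_)
open import Data.Fin using (Fin; zero; suc; _↑ˡ_; _↑ʳ_; combine; remQuot)
open import Data.Fin.Properties using (_≟_; remQuot-combine; suc-injective)
open import Data.Fin.Subset using (Subset; _∈_; _∉_; _⊆_; ∁; _∩_; ∣_∣)
open import Data.Fin.Subset.Properties
  using (p⊆q⇒∣p∣≤∣q∣; ∣⊥∣≡0; Empty-unique; x∈p∩q⁺; x∈p∩q⁻; x∉p⇒x∈∁p; x∈∁p⇒x∉p; ∣∁p∣≡n∸∣p∣; _∈?_)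
open import Data.Vec using ([]; _∷_; tabulate; lookup; here; there)
open import Data.Vec.Properties using (lookup∘tabulate; lookup⇒[]=; []=⇒lookup)
open import Data.Product using (_×_; _,_; proj₁; proj₂)
open import Data.Sum using (_⊎_; inj₁; inj₂; [_,_]′)
open import Data.Empty using (⊥; ⊥-elim)
open import Function using (id; _∘_)
open import Relation.Nullary using (yes; no)
open import Relation.Nullary.Decidable using (⌊_⌋; isYes≗does; dec-false)
open import Relation.Binary.PropositionalEquality
  using (_≡_; _≢_; refl; cong; cong₂; trans; subst; module ≡-Reasoning) renaming (sym to ≡-sym)
open import Algebra.Properties.Semiring.Sum ℕP.+-*-semiring
  using (sum; ∑-distrib-+; sum-cong-≗; *-distribˡ-sum; *-distribʳ-sum; sum-replicate-zero)

χ : Bool → ℕ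
χ true  = 1
χ false = 0

count : ∀ {n} → (Fin n → Bool) → ℕ
count f = sum (λ i → χ (f i))

∑-point : ∀ {n} (f : Fin n → ℕ) (a : Fin n) → (∀ i → i ≢ a → f i ≡ 0) → sum f ≡ f a
∑-point {suc n} f zero    f≡0 =
  trans (cong (_+_ (f zero)) (trans (sum-cong-≗ λ i → f≡0 (suc i) λ ()) (sum-replicate-zero n)))
        (ℕP.+-identityʳ (f zero))
∑-point {suc n} f (suc a) f≡0 =
  trans (cong (_+ sum (λ i → f (suc i))) (f≡0 zero λ ()))
        (∑-point (λ i → f (suc i)) a λ i i≢a → f≡0 (suc i) (i≢a ∘ suc-injective))

∑-δ : ∀ {n} (a : Fin n) (f : Fin n → ℕ) → sum (λ i → χ ⌊ a ≟ i ⌋ * f i) ≡ f a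
∑-δ a f =
  trans (∑-point _ a λ i i≢a → cong (λ b → χ b * f i) (⌊a≟i⌋≡false i (i≢a ∘ ≡-sym)))
        (trans (cong (λ b → χ b * f a) (≟-refl a)) (ℕP.*-identityˡ (f a)))
  where
  ⌊a≟i⌋≡false : ∀ i → a ≢ i → ⌊ a ≟ i ⌋ ≡ false
  ⌊a≟i⌋≡false i a≢i = trans (isYes≗does (a ≟ i)) (dec-false (a ≟ i) a≢i)

∑-↑ : ∀ m {n} (h : Fin (m + n) → ℕ) →
      sum h ≡ sum {m} (λ i → h (i ↑ˡ n)) + sum {n} (λ j → h (m ↑ʳ j))
∑-↑ zero    h = refl
∑-↑ (suc m) h = trans (cong (_+_ (h zero)) (∑-↑ m (λ i → h (suc i))))
                      (≡-sym (ℕP.+-assoc (h zero) _ _))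

∑-combine : ∀ m {n} (h : Fin (m * n) → ℕ) →
            sum h ≡ sum {m} (λ i → sum {n} (λ j → h (combine i j)))
∑-combine zero    h = refl
∑-combine (suc m) {n} h =
  trans (∑-↑ n h) (cong (_+_ (sum {n} (λ j → h (j ↑ˡ (m * n))))) (∑-combine m (λ x → h (n ↑ʳ x))))

∑-remQuot : ∀ m {n} (F : Fin m → Fin n → ℕ) →
            sum (λ x → F (proj₁ (remQuot {m} n x)) (proj₂ (remQuot {m} n x)))
            ≡ sum (λ i → sum (λ j → F i j))
∑-remQuot m {n} F = trans (∑-combine m _)
  (sum-cong-≗ λ i → sum-cong-≗ λ j → cong (λ ij → F (proj₁ ij) (proj₂ ij)) (remQuot-combine i j))

∣∣≡count : ∀ {n} (p : Subset n) → ∣ p ∣ ≡ count (lookup p)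
∣∣≡count []          = refl
∣∣≡count (true ∷ p)  = cong suc (∣∣≡count p)
∣∣≡count (false ∷ p) = ∣∣≡count p

∣tabulate∣ : ∀ {n} (f : Fin n → Bool) → ∣ tabulate f ∣ ≡ count f
∣tabulate∣ f = trans (∣∣≡count (tabulate f)) (sum-cong-≗ λ i → cong χ (lookup∘tabulate f i))

∣tabulate-pairs∣ : ∀ {m n} (F : Fin m → Fin n → Bool) →
  ∣ tabulate (λ x → F (proj₁ (remQuot {m} n x)) (proj₂ (remQuot {m} n x))) ∣
  ≡ sum (λ i → count (F i))
∣tabulate-pairs∣ {m} {n} F = trans (∣tabulate∣ {m * n} _) (∑-remQuot m (λ i j → χ (F i j)))

∈-tabulate⁻ : ∀ {n} {f : Fin n → Bool} {x} → x ∈ tabulate f → f x ≡ true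
∈-tabulate⁻ {f = f} {x} x∈ = trans (≡-sym (lookup∘tabulate f x)) ([]=⇒lookup x∈)

χ-∧-∨ : ∀ x y z → (x ≡ true → z ≡ true → ⊥) → χ ((x ∧ y) ∨ z) ≡ χ x * χ y + χ z
χ-∧-∨ false y     z     _      = refl
χ-∧-∨ true  y     true  x⊥z    = ⊥-elim (x⊥z refl refl)
χ-∧-∨ true  true  false _      = refl
χ-∧-∨ true  false false _      = refl

-- The order-preserving partial matching between subsets p ⊆ Fin m and q ⊆ Fin n:
-- pairing p q i j holds iff i is the r-th element of p and j the r-th
-- element of q for some r.
pairing : ∀ {m n} → Subset m → Subset n → Fin m → Fin n → Bool
pairing (false ∷ p) q           zero    j       = false
pairing (false ∷ p) q           (suc i) j       = pairing p q i j
pairing (true ∷ p)  (false ∷ q) i       zero    = false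
pairing (true ∷ p)  (false ∷ q) i       (suc j) = pairing (true ∷ p) q i j
pairing (true ∷ p)  (true ∷ q)  zero    zero    = true
pairing (true ∷ p)  (true ∷ q)  zero    (suc j) = false
pairing (true ∷ p)  (true ∷ q)  (suc i) zero    = false
pairing (true ∷ p)  (true ∷ q)  (suc i) (suc j) = pairing p q i j

pairing-⊆ˡ : ∀ {m n} (p : Subset m) (q : Subset n) i j → pairing p q i j ≡ true → i ∈ p
pairing-⊆ˡ (false ∷ p) q           zero    j       ()
pairing-⊆ˡ (false ∷ p) q           (suc i) j       e  = there (pairing-⊆ˡ p q i j e)
pairing-⊆ˡ (true ∷ p)  (false ∷ q) i       zero    ()
pairing-⊆ˡ (true ∷ p)  (false ∷ q) i       (suc j) e  = pairing-⊆ˡ (true ∷ p) q i j e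
pairing-⊆ˡ (true ∷ p)  (true ∷ q)  zero    zero    _  = here
pairing-⊆ˡ (true ∷ p)  (true ∷ q)  zero    (suc j) ()
pairing-⊆ˡ (true ∷ p)  (true ∷ q)  (suc i) zero    ()
pairing-⊆ˡ (true ∷ p)  (true ∷ q)  (suc i) (suc j) e  = there (pairing-⊆ˡ p q i j e)

pairing-⊆ʳ : ∀ {m n} (p : Subset m) (q : Subset n) i j → pairing p q i j ≡ true → j ∈ q
pairing-⊆ʳ (false ∷ p) q           zero    j       ()
pairing-⊆ʳ (false ∷ p) q           (suc i) j       e  = pairing-⊆ʳ p q i j e
pairing-⊆ʳ (true ∷ p)  (false ∷ q) i       zero    ()
pairing-⊆ʳ (true ∷ p)  (false ∷ q) i       (suc j) e  = there (pairing-⊆ʳ (true ∷ p) q i j e)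
pairing-⊆ʳ (true ∷ p)  (true ∷ q)  zero    zero    _  = here
pairing-⊆ʳ (true ∷ p)  (true ∷ q)  zero    (suc j) ()
pairing-⊆ʳ (true ∷ p)  (true ∷ q)  (suc i) zero    ()
pairing-⊆ʳ (true ∷ p)  (true ∷ q)  (suc i) (suc j) e  = there (pairing-⊆ʳ p q i j e)

pairing-functional : ∀ {m n} (p : Subset m) (q : Subset n) i j j′ →
  pairing p q i j ≡ true → pairing p q i j′ ≡ true → j ≡ j′
pairing-functional (false ∷ p) q           zero    j       j′      ()
pairing-functional (false ∷ p) q           (suc i) j       j′      e e′ = pairing-functional p q i j j′ e e′
pairing-functional (true ∷ p)  (false ∷ q) i       zero    j′      ()
pairing-functional (true ∷ p)  (false ∷ q) i       (suc j) zero    _ ()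
pairing-functional (true ∷ p)  (false ∷ q) i       (suc j) (suc j′) e e′ =
  cong suc (pairing-functional (true ∷ p) q i j j′ e e′)
pairing-functional (true ∷ p)  (true ∷ q)  zero    zero    zero    _ _ = refl
pairing-functional (true ∷ p)  (true ∷ q)  zero    zero    (suc j′) _ ()
pairing-functional (true ∷ p)  (true ∷ q)  zero    (suc j) j′      ()
pairing-functional (true ∷ p)  (true ∷ q)  (suc i) zero    j′      ()
pairing-functional (true ∷ p)  (true ∷ q)  (suc i) (suc j) zero    _ ()
pairing-functional (true ∷ p)  (true ∷ q)  (suc i) (suc j) (suc j′) e e′ =
  cong suc (pairing-functional p q i j j′ e e′)

pairing-injective : ∀ {m n} (p : Subset m) (q : Subset n) i i′ j →
  pairing p q i j ≡ true → pairing p q i′ j ≡ true → i ≡ i′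
pairing-injective (false ∷ p) q           zero    i′      j       ()
pairing-injective (false ∷ p) q           (suc i) zero    j       _ ()
pairing-injective (false ∷ p) q           (suc i) (suc i′) j      e e′ =
  cong suc (pairing-injective p q i i′ j e e′)
pairing-injective (true ∷ p)  (false ∷ q) i       i′      zero    ()
pairing-injective (true ∷ p)  (false ∷ q) i       i′      (suc j) e e′ =
  pairing-injective (true ∷ p) q i i′ j e e′
pairing-injective (true ∷ p)  (true ∷ q)  zero    zero    zero    _ _ = refl
pairing-injective (true ∷ p)  (true ∷ q)  zero    (suc i′) zero   _ ()
pairing-injective (true ∷ p)  (true ∷ q)  (suc i) i′      zero    ()
pairing-injective (true ∷ p)  (true ∷ q)  zero    i′      (suc j) ()
pairing-injective (true ∷ p)  (true ∷ q)  (suc i) zero    (suc j) _ ()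
pairing-injective (true ∷ p)  (true ∷ q)  (suc i) (suc i′) (suc j) e e′ =
  cong suc (pairing-injective p q i i′ j e e′)

pairing-size : ∀ {m n} (p : Subset m) (q : Subset n) →
  sum (λ i → count (pairing p q i)) ≡ ∣ p ∣ ⊓ ∣ q ∣
pairing-size []                    q           = refl
pairing-size {suc m} (x ∷ p)       []          =
  trans (sum-replicate-zero (suc m)) (≡-sym (ℕP.⊓-zeroʳ ∣ x ∷ p ∣))
pairing-size {n = n} (false ∷ p)   q           =
  trans (cong (_+ sum (λ i → count (pairing p q i))) (sum-replicate-zero n)) (pairing-size p q)
pairing-size         (true ∷ p)    (false ∷ q) = pairing-size (true ∷ p) q
pairing-size {n = suc n} (true ∷ p) (true ∷ q) =
  cong₂ (λ a b → suc a + b) (sum-replicate-zero n) (pairing-size p q)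

Independentᵇ : ∀ {n} → Graph n → (Fin n → Bool) → Set
Independentᵇ G f = ∀ u v → f u ≡ true → f v ≡ true → adj G u v ≡ false

independent-⊆ : ∀ {n} (G : Graph n) {I : Subset n} {f : Fin n → Bool} →
  Independent G I → (∀ v → f v ≡ true → v ∈ I) → Independentᵇ G f
independent-⊆ G I-ind f⊆I u v fu fv = I-ind u v (f⊆I u fu) (f⊆I v fv)

independent-subsingleton : ∀ {n} (G : Graph n) {f : Fin n → Bool} →
  (∀ u v → f u ≡ true → f v ≡ true → u ≡ v) → Independentᵇ G f
independent-subsingleton G f≤1 u v fu fv =
  subst (λ w → adj G w v ≡ false) (≡-sym (f≤1 u v fu fv)) (irrefl G v)

neighbours-outside : ∀ {n} (G : Graph n) {X S : Subset n} {v : Fin n} →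
  Independent G X → S ⊆ X → v ∈ S → N G v ⊆ ∁ S
neighbours-outside G X-ind S⊆X v∈S {u} u∈Nv = x∉p⇒x∈∁p λ u∈S →
  true≢false (trans (≡-sym (∈-tabulate⁻ u∈Nv)) (X-ind _ u (S⊆X v∈S) (S⊆X u∈S)))
  where
  true≢false : true ≢ false
  true≢false ()

-- An independent set in a graph of minimum degree at least d is defensive
-- k-alliance free for every k ≥ 1 - d: a vertex v of a non-empty S ⊆ X has
-- δ_S(v) = 0, while δ_{∁S}(v) + k ≥ deg v + k ≥ d + k ≥ 1.
independent⇒daf : ∀ {n} (G : Graph n) (X : Subset n) (d : ℕ) (k : ℤ) →
  Independent G X → (∀ v → d ≤ℕ deg G v) → + 1 - + d ≤ k → IsDAF G k X
independent⇒daf {n} G X d k X-ind d≤deg 1-d≤k S S⊆X ((v , v∈S) , defends) = +1≰+0 (begin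
  + 1                     ≡⟨ 1≡a+[1-a] (+ d) ⟩
  + d +ℤ (+ 1 - + d)      ≤⟨ ℤP.+-mono-≤ (+≤+ (ℕP.≤-trans (d≤deg v) outside-large)) 1-d≤k ⟩
  + ∣ ∁ S ∩ N G v ∣ +ℤ k  ≤⟨ defends v v∈S ⟩
  + ∣ S ∩ N G v ∣         ≡⟨ cong +_ inside-empty ⟩
  + 0                     ∎)
  where
  open ℤP.≤-Reasoning
  1≡a+[1-a] : ∀ a → + 1 ≡ a +ℤ (+ 1 - a)
  1≡a+[1-a] = solve-∀
  +1≰+0 : + 1 ≤ + 0 → ⊥
  +1≰+0 (+≤+ ())
  Nv⊆∁S : N G v ⊆ ∁ S
  Nv⊆∁S = neighbours-outside G X-ind S⊆X v∈S
  outside-large : deg G v ≤ℕ ∣ ∁ S ∩ N G v ∣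
  outside-large = p⊆q⇒∣p∣≤∣q∣ λ u∈Nv → x∈p∩q⁺ (Nv⊆∁S u∈Nv , u∈Nv)
  inside-empty : ∣ S ∩ N G v ∣ ≡ 0
  inside-empty = trans (cong ∣_∣ (Empty-unique λ (u , u∈S∩Nv) →
      x∈∁p⇒x∉p (Nv⊆∁S (proj₂ (x∈p∩q⁻ S (N G v) u∈S∩Nv))) (proj₁ (x∈p∩q⁻ S (N G v) u∈S∩Nv))))
    (∣⊥∣≡0 n)

module Product {n₁ n₂ : ℕ} (G₁ : Graph n₁) (G₂ : Graph n₂) where

  first : Fin (n₁ * n₂) → Fin n₁
  first x = proj₁ (remQuot {n₁} n₂ x)

  second : Fin (n₁ * n₂) → Fin n₂
  second x = proj₂ (remQuot {n₁} n₂ x)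

  χ-□adj : ∀ a b i j → χ (□adj G₁ G₂ (a , b) (i , j))
                       ≡ χ ⌊ a ≟ i ⌋ * χ (adj G₂ b j) + χ ⌊ b ≟ j ⌋ * χ (adj G₁ a i)
  χ-□adj a b i j with a ≟ i | b ≟ j
  ... | yes refl | yes refl rewrite irrefl G₁ a | irrefl G₂ b = refl
  ... | no _     | no _     = refl
  ... | yes refl | no _ with adj G₂ b j
  ...   | true  = refl
  ...   | false = refl
  χ-□adj a b i j | no _ | yes refl with adj G₁ a i
  ...   | true  = refl
  ...   | false = refl

  □-deg : ∀ v → deg (G₁ □ G₂) v ≡ deg G₁ (first v) + deg G₂ (second v)
  □-deg v = begin
    deg (G₁ □ G₂) v
      ≡⟨ ∣tabulate-pairs∣ (λ i j → □adj G₁ G₂ (a , b) (i , j)) ⟩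
    sum (λ i → count (λ j → □adj G₁ G₂ (a , b) (i , j)))
      ≡⟨ sum-cong-≗ row ⟩
    sum (λ i → χ ⌊ a ≟ i ⌋ * deg G₂ b + χ (adj G₁ a i))
      ≡⟨ ∑-distrib-+ (λ i → χ ⌊ a ≟ i ⌋ * deg G₂ b) (λ i → χ (adj G₁ a i)) ⟩
    sum (λ i → χ ⌊ a ≟ i ⌋ * deg G₂ b) + count (adj G₁ a)
      ≡⟨ cong₂ _+_ (∑-δ a (λ _ → deg G₂ b)) (≡-sym (∣tabulate∣ (adj G₁ a))) ⟩
    deg G₂ b + deg G₁ a
      ≡⟨ ℕP.+-comm (deg G₂ b) (deg G₁ a) ⟩
    deg G₁ a + deg G₂ b ∎
    where
    open ≡-Reasoning
    a = first v
    b = second v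
    row : ∀ i → count (λ j → □adj G₁ G₂ (a , b) (i , j)) ≡ χ ⌊ a ≟ i ⌋ * deg G₂ b + χ (adj G₁ a i)
    row i = begin
      count (λ j → □adj G₁ G₂ (a , b) (i , j))
        ≡⟨ sum-cong-≗ (χ-□adj a b i) ⟩
      sum (λ j → χ ⌊ a ≟ i ⌋ * χ (adj G₂ b j) + χ ⌊ b ≟ j ⌋ * χ (adj G₁ a i))
        ≡⟨ ∑-distrib-+ (λ j → χ ⌊ a ≟ i ⌋ * χ (adj G₂ b j)) (λ j → χ ⌊ b ≟ j ⌋ * χ (adj G₁ a i)) ⟩
      sum (λ j → χ ⌊ a ≟ i ⌋ * χ (adj G₂ b j)) + sum (λ j → χ ⌊ b ≟ j ⌋ * χ (adj G₁ a i))
        ≡⟨ cong₂ _+_ (≡-sym (*-distribˡ-sum (χ ⌊ a ≟ i ⌋) (λ j → χ (adj G₂ b j))))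
                     (∑-δ b (λ _ → χ (adj G₁ a i))) ⟩
      χ ⌊ a ≟ i ⌋ * count (adj G₂ b) + χ (adj G₁ a i)
        ≡⟨ cong (λ d → χ ⌊ a ≟ i ⌋ * d + χ (adj G₁ a i)) (≡-sym (∣tabulate∣ (adj G₂ b))) ⟩
      χ ⌊ a ≟ i ⌋ * deg G₂ b + χ (adj G₁ a i) ∎

  □-minDegree : ∀ {δ₁ δ₂} → (∀ a → δ₁ ≤ℕ deg G₁ a) → (∀ b → δ₂ ≤ℕ deg G₂ b) →
                ∀ v → δ₁ + δ₂ ≤ℕ deg (G₁ □ G₂) v
  □-minDegree δ₁≤deg δ₂≤deg v =
    ℕP.≤-trans (ℕP.+-mono-≤ (δ₁≤deg (first v)) (δ₂≤deg (second v))) (ℕP.≤-reflexive (≡-sym (□-deg v)))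

  □-independent : (g : Fin n₁ → Fin n₂ → Bool) →
    (∀ a → Independentᵇ G₂ (g a)) → (∀ b → Independentᵇ G₁ (λ a → g a b)) →
    Independent (G₁ □ G₂) (tabulate (λ x → g (first x) (second x)))
  □-independent g rows-ind cols-ind x y x∈ y∈ =
    no-edge (first x) (second x) (first y) (second y) (∈-tabulate⁻ x∈) (∈-tabulate⁻ y∈)
    where
    no-edge : ∀ a b c d → g a b ≡ true → g c d ≡ true → □adj G₁ G₂ (a , b) (c , d) ≡ false
    no-edge a b c d gab gcd with a ≟ c | b ≟ d
    ... | yes refl | yes refl rewrite rows-ind a b b gab gab | cols-ind b a a gab gab = refl
    ... | yes refl | no _     rewrite rows-ind a b d gab gcd = refl
    ... | no _     | yes refl rewrite cols-ind b a c gab gcd = refl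
    ... | no _     | no _     = refl

module Construction {n₁ n₂ : ℕ} (G₁ : Graph n₁) (G₂ : Graph n₂)
  {I₁ : Subset n₁} {I₂ : Subset n₂} (I₁-ind : Independent G₁ I₁) (I₂-ind : Independent G₂ I₂) where

  open Product G₁ G₂

  M : Fin n₁ → Fin n₂ → Bool
  M = pairing (∁ I₁) (∁ I₂)

  inX : Fin n₁ → Fin n₂ → Bool
  inX a b = (lookup I₁ a ∧ lookup I₂ b) ∨ M a b

  X : Subset (n₁ * n₂)
  X = tabulate (λ x → inX (first x) (second x))

  M-outside₁ : ∀ {a b} → M a b ≡ true → a ∉ I₁
  M-outside₁ {a} {b} Mab = x∈∁p⇒x∉p (pairing-⊆ˡ (∁ I₁) (∁ I₂) a b Mab)

  M-outside₂ : ∀ {a b} → M a b ≡ true → b ∉ I₂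
  M-outside₂ {a} {b} Mab = x∈∁p⇒x∉p (pairing-⊆ʳ (∁ I₁) (∁ I₂) a b Mab)

  inX-cases : ∀ a b → inX a b ≡ true → (a ∈ I₁ × b ∈ I₂) ⊎ M a b ≡ true
  inX-cases a b ab∈X with lookup I₁ a in e₁ | lookup I₂ b in e₂
  ... | true  | true  = inj₁ (lookup⇒[]= a I₁ e₁ , lookup⇒[]= b I₂ e₂)
  ... | true  | false = inj₂ ab∈X
  ... | false | _     = inj₂ ab∈X

  -- Row a of X is contained in I₂ if a ∈ I₁, and is a matched singleton otherwise.
  rows-independent : ∀ a → Independentᵇ G₂ (inX a)
  rows-independent a with a ∈? I₁
  ... | yes a∈I₁ = independent-⊆ G₂ I₂-ind λ b ab∈X →
    [ proj₂ , (λ Mab → ⊥-elim (M-outside₁ Mab a∈I₁)) ]′ (inX-cases a b ab∈X)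
  ... | no a∉I₁ = independent-subsingleton G₂ λ b b′ ab∈X ab′∈X →
    pairing-functional (∁ I₁) (∁ I₂) a b b′ (matched b ab∈X) (matched b′ ab′∈X)
    where
    matched : ∀ b → inX a b ≡ true → M a b ≡ true
    matched b ab∈X = [ (λ a∈I₁×b∈I₂ → ⊥-elim (a∉I₁ (proj₁ a∈I₁×b∈I₂))) , id ]′ (inX-cases a b ab∈X)

  columns-independent : ∀ b → Independentᵇ G₁ (λ a → inX a b)
  columns-independent b with b ∈? I₂
  ... | yes b∈I₂ = independent-⊆ G₁ I₁-ind λ a ab∈X →
    [ proj₁ , (λ Mab → ⊥-elim (M-outside₂ Mab b∈I₂)) ]′ (inX-cases a b ab∈X)
  ... | no b∉I₂ = independent-subsingleton G₁ λ a a′ ab∈X a′b∈X →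
    pairing-injective (∁ I₁) (∁ I₂) a a′ b (matched a ab∈X) (matched a′ a′b∈X)
    where
    matched : ∀ a → inX a b ≡ true → M a b ≡ true
    matched a ab∈X = [ (λ a∈I₁×b∈I₂ → ⊥-elim (b∉I₂ (proj₂ a∈I₁×b∈I₂))) , id ]′ (inX-cases a b ab∈X)

  X-independent : Independent (G₁ □ G₂) X
  X-independent = □-independent inX rows-independent columns-independent

  row-size : ∀ a → count (inX a) ≡ χ (lookup I₁ a) * count (lookup I₂) + count (M a)
  row-size a = begin
    count (inX a)
      ≡⟨ sum-cong-≗ (λ b → χ-∧-∨ (lookup I₁ a) (lookup I₂ b) (M a b)
                            λ a∈I₁ Mab → M-outside₁ Mab (lookup⇒[]= a I₁ a∈I₁)) ⟩
    sum (λ b → χ (lookup I₁ a) * χ (lookup I₂ b) + χ (M a b))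
      ≡⟨ ∑-distrib-+ (λ b → χ (lookup I₁ a) * χ (lookup I₂ b)) (λ b → χ (M a b)) ⟩
    sum (λ b → χ (lookup I₁ a) * χ (lookup I₂ b)) + count (M a)
      ≡⟨ cong (_+ count (M a)) (≡-sym (*-distribˡ-sum (χ (lookup I₁ a)) (λ b → χ (lookup I₂ b)))) ⟩
    χ (lookup I₁ a) * count (lookup I₂) + count (M a) ∎
    where open ≡-Reasoning

  ∣X∣ : ∣ X ∣ ≡ ∣ I₁ ∣ * ∣ I₂ ∣ + ∣ ∁ I₁ ∣ ⊓ ∣ ∁ I₂ ∣
  ∣X∣ = begin
    ∣ X ∣
      ≡⟨ ∣tabulate-pairs∣ inX ⟩
    sum (λ a → count (inX a))
      ≡⟨ sum-cong-≗ row-size ⟩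
    sum (λ a → χ (lookup I₁ a) * count (lookup I₂) + count (M a))
      ≡⟨ ∑-distrib-+ (λ a → χ (lookup I₁ a) * count (lookup I₂)) (λ a → count (M a)) ⟩
    sum (λ a → χ (lookup I₁ a) * count (lookup I₂)) + sum (λ a → count (M a))
      ≡⟨ cong₂ _+_ (≡-sym (*-distribʳ-sum (count (lookup I₂)) (λ a → χ (lookup I₁ a))))
                   (pairing-size (∁ I₁) (∁ I₂)) ⟩
    count (lookup I₁) * count (lookup I₂) + ∣ ∁ I₁ ∣ ⊓ ∣ ∁ I₂ ∣
      ≡⟨ cong (_+ ∣ ∁ I₁ ∣ ⊓ ∣ ∁ I₂ ∣) (≡-sym (cong₂ _*_ (∣∣≡count I₁) (∣∣≡count I₂))) ⟩
    ∣ I₁ ∣ * ∣ I₂ ∣ + ∣ ∁ I₁ ∣ ⊓ ∣ ∁ I₂ ∣ ∎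
    where open ≡-Reasoning

mainTheorem1 : ∀ {n₁ n₂ : ℕ} (G₁ : Graph n₁) (G₂ : Graph n₂)
    (δ₁ Δ₁ α₁ δ₂ Δ₂ α₂ : ℕ) →
    IsMinDegree G₁ δ₁ → IsMaxDegree G₁ Δ₁ → IsIndependenceNumber G₁ α₁ →
    IsMinDegree G₂ δ₂ → IsMaxDegree G₂ Δ₂ → IsIndependenceNumber G₂ α₂ →
    (k : ℤ) → + 1 - + δ₁ - + δ₂ ≤ k → k ≤ + Δ₁ +ℤ + Δ₂ →
    φ≥ (G₁ □ G₂) k (α₁ * α₂ + ((n₁ ∸ α₁) ⊓ (n₂ ∸ α₂)))
mainTheorem1 {n₁} {n₂} G₁ G₂ δ₁ _ α₁ δ₂ _ α₂
  (_ , δ₁≤deg) _ ((I₁ , I₁-ind , ∣I₁∣≡α₁) , _)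
  (_ , δ₂≤deg) _ ((I₂ , I₂-ind , ∣I₂∣≡α₂) , _) k 1-δ₁-δ₂≤k _ =
  X , independent⇒daf (G₁ □ G₂) X (δ₁ + δ₂) k X-independent
        (□-minDegree δ₁≤deg δ₂≤deg) (subst (_≤ k) lower-bound 1-δ₁-δ₂≤k)
    , ℕP.≤-reflexive (≡-sym size)
  where
  open Product G₁ G₂
  open Construction G₁ G₂ I₁-ind I₂-ind
  lower-bound : + 1 - + δ₁ - + δ₂ ≡ + 1 - + (δ₁ + δ₂)
  lower-bound = trans (1-a-b≡1-[a+b] (+ δ₁) (+ δ₂)) (cong (λ d → + 1 - d) (≡-sym (ℤP.pos-+ δ₁ δ₂)))
    where
    1-a-b≡1-[a+b] : ∀ a b → + 1 - a - b ≡ + 1 - (a +ℤ b)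
    1-a-b≡1-[a+b] = solve-∀
  size : ∣ X ∣ ≡ α₁ * α₂ + ((n₁ ∸ α₁) ⊓ (n₂ ∸ α₂))
  size rewrite ∣X∣ | ∣∁p∣≡n∸∣p∣ I₁ | ∣∁p∣≡n∸∣p∣ I₂ | ∣I₁∣≡α₁ | ∣I₂∣≡α₂ = refl
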